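{- Let $S\subseteq\mathbb N^d$ be a good semigroup, $E\subseteq S$ a good ideal, $\alpha\in E$ and $F\subsetneq I$. Assume there exists a set $H\subseteq I$ of cardinality $d-1$ with $F\subseteq H$ such that $\Delta^E_G(\alpha)=\emptyset$ for every $G$ with $F\subseteq G\subseteq H$. Then $\Delta^E_{\widehat F}(\alpha)=\emptyset$.
   Context: $\mathbb N$ denotes the nonnegative integers, $I=\{1,\dots,d\}$, $\le$ is the componentwise order on $\mathbb N^d$, $\alpha\wedge\beta$ the componentwise minimum, $\widehat F=I\setminus F$. A good semigroup is a submonoid $S$ of $(\mathbb N^d,+)$ such that (G1) $\alpha\wedge\beta\in S$ for $\alpha,\beta\in S$; (G2) if $\alpha,\beta\in S$, $\alpha\ne\beta$, $\alpha_i=\beta_i$ for some $i$, then there is $\epsilon\in S$ with $\epsilon_i>\alpha_i$ and $\epsilon_j\ge\min(\alpha_j,\beta_j)$ for $j\ne i$, with equality when $\alpha_j\ne\beta_j$; (G3) there is $c\in S$ with $c+\mathbb N^d\subseteq S$. A good ideal of $S$ is a subset $E\subseteq S$ with $E+S\subseteq E$ satisfying (G1), (G2) with all elements taken in $E$. For $X\subseteq\mathbb N^d$, $F\subseteq I$, $\alpha\in\mathbb N^d$: $\Delta^X_F(\alpha)=\{\beta\in X:\beta_i=\alpha_i\ (i\in F),\ \beta_j>\alpha_j\ (j\notin F)\}$. -}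

module Defs where

open import Data.Nat using (ℕ; _+_; _<_; _≤_; _⊓_)
open import Data.Fin using (Fin)
open import Data.Fin.Subset using (Subset; _∈_; _∉_)
open import Data.Product using (Σ; _×_; ∃)
open import Relation.Nullary using (¬_)
open import Relation.Binary.PropositionalEquality using (_≡_; _≢_)

Vecℕ : ℕ → Set
Vecℕ d = Fin d → ℕ

SubsetNd : ℕ → Set₁
SubsetNd d = Vecℕ d → Set

zeroV : ∀ {d} → Vecℕ d
zeroV _ = 0

_⊕_ : ∀ {d} → Vecℕ d → Vecℕ d → Vecℕ d
(α ⊕ β) i = α i + β i

_∧_ : ∀ {d} → Vecℕ d → Vecℕ d → Vecℕ d
(α ∧ β) i = α i ⊓ β i

_≈_ : ∀ {d} → Vecℕ d → Vecℕ d → Set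
α ≈ β = ∀ i → α i ≡ β i

G1 : ∀ {d} → SubsetNd d → Set
G1 X = ∀ α β → X α → X β → X (α ∧ β)

G2 : ∀ {d} → SubsetNd d → Set
G2 {d} X = ∀ α β (i : Fin d) → X α → X β → ¬ (α ≈ β) → α i ≡ β i →
  Σ (Vecℕ d) λ ε → X ε × α i < ε i ×
    (∀ j → j ≢ i → (α j ⊓ β j ≤ ε j) × (α j ≢ β j → ε j ≡ α j ⊓ β j))

G3 : ∀ {d} → SubsetNd d → Set
G3 {d} X = Σ (Vecℕ d) λ c → X c × (∀ v → X (c ⊕ v))

IsSubmonoid : ∀ {d} → SubsetNd d → Set
IsSubmonoid X = X zeroV × (∀ α β → X α → X β → X (α ⊕ β))

IsGoodSemigroup : ∀ {d} → SubsetNd d → Set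
IsGoodSemigroup S = IsSubmonoid S × G1 S × G2 S × G3 S

IsGoodIdeal : ∀ {d} → SubsetNd d → SubsetNd d → Set
IsGoodIdeal {d} S E =
  (∀ α → E α → S α) × (∀ α s → E α → S s → E (α ⊕ s)) × G1 E × G2 E

Δ : ∀ {d} → SubsetNd d → Subset d → Vecℕ d → Vecℕ d → Set
Δ {d} X F α β = X β × (∀ i → i ∈ F → β i ≡ α i) × (∀ j → j ∉ F → α j < β j)

IsEmptyΔ : ∀ {d} → SubsetNd d → Subset d → Vecℕ d → Set
IsEmptyΔ X F α = ∀ β → ¬ Δ X F α β

-- Let β ∈ Δ^E_{∁F}(α) and let k be the unique index outside H; then k ∉ F, so β agrees
-- with α at k and exceeds it on F. Axiom (G2) applied to α and β at k (or, when F = ∅,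
-- a translate of α by the conductor) gives ε ∈ E with ε ≥ α, ε_k > α_k and ε = α on F.
-- Such an ε lies in Δ^E_G(α) for the set G where ε and α agree, and F ⊆ G ⊆ H.
module Submission where

open import Defs
open import Data.Nat using (ℕ; zero; suc; _∸_; _<_; _≤_; _⊓_; _≟_)
open import Data.Nat.Properties
  using (<⇒≤; ≤-reflexive; ≤∧≢⇒<; <-irrefl; ≤⇒≯; <⇒≢; m≤n⇒m⊓n≡m; m+n∸n≡m; m<m+n; m≤n+m)
open import Data.Fin using (Fin) renaming (_≟_ to _≟ᶠ_)
open import Data.Fin.Subset using (Subset; _⊆_; ∁; ⊤; ⁅_⁆; _-_; ∣_∣; _∈_; _∉_; Nonempty)
open import Data.Fin.Subset.Properties
  using (_∈?_; nonempty?; Empty-unique; ∣⊥∣≡0; ∣⁅x⁆∣≡1; x∈⁅y⁆⇒x≡y; x∈p∧x≢y⇒x∈p-y;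
         x∈p⇒∣p-x∣<∣p∣; p⊆q⇒∣p∣≤∣q∣; ∣∁p∣≡n∸∣p∣; x∈p⇒x∉∁p; x∉p⇒x∈∁p; x∈∁p⇒x∉p)
open import Data.Vec.Base using ([]; tabulate)
open import Data.Vec.Properties using (lookup∘tabulate; lookup⇒[]=; []=⇒lookup)
open import Data.Product using (Σ; ∃; _×_; _,_; proj₁; proj₂)
open import Relation.Nullary using (¬_; Dec; yes; no; does; contradiction)
open import Relation.Nullary.Decidable using (dec-true)
open import Level using (Level)
open import Relation.Unary using (Pred; Decidable)
open import Relation.Binary.PropositionalEquality using (_≡_; _≢_; ≢-sym; refl; sym; trans; cong; subst)

private variable
  ℓ : Level
  n : ℕ

subsetOf : {P : Pred (Fin n) ℓ} → Decidable P → Subset n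
subsetOf P? = tabulate λ i → does (P? i)

module _ {P : Pred (Fin n) ℓ} (P? : Decidable P) where

  ∈-subsetOf⁺ : ∀ {i} → P i → i ∈ subsetOf P?
  ∈-subsetOf⁺ {i} Pi = lookup⇒[]= i _ (trans (lookup∘tabulate _ i) (dec-true (P? i) Pi))

  ∈-subsetOf⁻ : ∀ {i} → i ∈ subsetOf P? → P i
  ∈-subsetOf⁻ {i} i∈ with P? i | trans (sym (lookup∘tabulate _ i)) ([]=⇒lookup i∈)
  ... | yes Pi | _ = Pi
  ... | no _ | ()

∣p∣≡1⇒singleton : {p : Subset n} → ∣ p ∣ ≡ 1 → ∃ λ k → k ∈ p × (∀ {j} → j ∈ p → j ≡ k)
∣p∣≡1⇒singleton {n} {p} ∣p∣≡1 with nonempty? p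
... | no p-empty =
  contradiction (trans (sym ∣p∣≡1) (trans (cong ∣_∣ (Empty-unique p-empty)) (∣⊥∣≡0 n))) λ ()
... | yes (k , k∈p) = k , k∈p , unique
  where
  unique : ∀ {j} → j ∈ p → j ≡ k
  unique {j} j∈p with j ≟ᶠ k
  ... | yes j≡k = j≡k
  ... | no j≢k = contradiction ∣p-k∣<1 (≤⇒≯ 1≤∣p-k∣)
    where
    ⁅j⁆⊆p-k : ⁅ j ⁆ ⊆ p - k
    ⁅j⁆⊆p-k x∈⁅j⁆ = subst (_∈ p - k) (sym (x∈⁅y⁆⇒x≡y j x∈⁅j⁆)) (x∈p∧x≢y⇒x∈p-y j∈p j≢k)
    1≤∣p-k∣ : 1 ≤ ∣ p - k ∣
    1≤∣p-k∣ = subst (_≤ ∣ p - k ∣) (∣⁅x⁆∣≡1 j) (p⊆q⇒∣p∣≤∣q∣ ⁅j⁆⊆p-k)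
    ∣p-k∣<1 : ∣ p - k ∣ < 1
    ∣p-k∣<1 = subst (∣ p - k ∣ <_) ∣p∣≡1 (x∈p⇒∣p-x∣<∣p∣ k∈p)

∣p∣≡n⇒unique∉ : {p : Subset (suc n)} → ∣ p ∣ ≡ n → ∃ λ k → k ∉ p × (∀ {j} → j ∉ p → j ≡ k)
∣p∣≡n⇒unique∉ {n} {p} ∣p∣≡n with ∣p∣≡1⇒singleton ∣∁p∣≡1
  where
  ∣∁p∣≡1 : ∣ ∁ p ∣ ≡ 1
  ∣∁p∣≡1 = trans (∣∁p∣≡n∸∣p∣ p) (trans (cong (suc n ∸_) ∣p∣≡n) (m+n∸n≡m 1 n))
... | k , k∈∁p , unique = k , x∈∁p⇒x∉p k∈∁p , λ j∉p → unique (x∉p⇒x∈∁p j∉p)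

module _ {d : ℕ} where

  _≼_ : Vecℕ d → Vecℕ d → Set
  α ≼ β = ∀ i → α i ≤ β i

  agreement : Vecℕ d → Vecℕ d → Subset d
  agreement ε α = subsetOf λ i → ε i ≟ α i

  ∈-agreement⁺ : ∀ ε α {i} → ε i ≡ α i → i ∈ agreement ε α
  ∈-agreement⁺ ε α = ∈-subsetOf⁺ λ i → ε i ≟ α i

  ∈-agreement⁻ : ∀ ε α {i} → i ∈ agreement ε α → ε i ≡ α i
  ∈-agreement⁻ ε α = ∈-subsetOf⁻ λ i → ε i ≟ α i

  Δ-agreement : ∀ {X : SubsetNd d} {α ε} → X ε → α ≼ ε → Δ X (agreement ε α) α ε
  Δ-agreement {α = α} {ε} Xε α≼ε =
    Xε ,
    (λ i → ∈-agreement⁻ ε α) ,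
    λ j j∉ → ≤∧≢⇒< (α≼ε j) λ αj≡εj → j∉ (∈-agreement⁺ ε α (sym αj≡εj))

  Δ∁⇒≼ : ∀ {X : SubsetNd d} {F α β} → Δ X (∁ F) α β → α ≼ β
  Δ∁⇒≼ {F = F} (_ , eq , gt) j with j ∈? F
  ... | yes j∈F = <⇒≤ (gt j (x∈p⇒x∉∁p j∈F))
  ... | no j∉F = ≤-reflexive (sym (eq j (x∉p⇒x∈∁p j∉F)))

  G2-step : ∀ {X : SubsetNd d} → G2 X → ∀ {α β} k → X α → X β → α ≼ β → ¬ (α ≈ β) → α k ≡ β k →
    Σ (Vecℕ d) λ ε → X ε × α ≼ ε × α k < ε k × (∀ j → α j < β j → ε j ≡ α j)
  G2-step g2 {α} {β} k Xα Xβ α≼β α≉β αk≡βk with g2 α β k Xα Xβ α≉β αk≡βk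
  ... | ε , Xε , αk<εk , off-k = ε , Xε , α≼ε , αk<εk , agree
    where
    α⊓β≡α : ∀ j → α j ⊓ β j ≡ α j
    α⊓β≡α j = m≤n⇒m⊓n≡m (α≼β j)
    α≼ε : α ≼ ε
    α≼ε j with j ≟ᶠ k
    ... | yes refl = <⇒≤ αk<εk
    ... | no j≢k = subst (_≤ ε j) (α⊓β≡α j) (proj₁ (off-k j j≢k))
    agree : ∀ j → α j < β j → ε j ≡ α j
    agree j αj<βj = trans (proj₂ (off-k j j≢k) (<⇒≢ αj<βj)) (α⊓β≡α j)
      where
      j≢k : j ≢ k
      j≢k refl = <-irrefl αk≡βk αj<βj

  ideal-above : ∀ {S E : SubsetNd d} → (∀ α s → E α → S s → E (α ⊕ s)) → G3 S →
    ∀ {α} → E α → Σ (Vecℕ d) λ ε → E ε × (∀ j → α j < ε j)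
  ideal-above E+S⊆E (c , _ , c+ℕ^d⊆S) {α} Eα =
    α ⊕ (c ⊕ λ _ → 1) , E+S⊆E α _ Eα (c+ℕ^d⊆S _) , λ j → m<m+n (α j) (m≤n+m 1 (c j))

  RaisedAt : SubsetNd d → Subset d → Vecℕ d → Fin d → Set
  RaisedAt E F α k = Σ (Vecℕ d) λ ε → E ε × α ≼ ε × α k < ε k × (∀ j → j ∈ F → ε j ≡ α j)

  raise-at : ∀ {S E : SubsetNd d} → (∀ α s → E α → S s → E (α ⊕ s)) → G3 S → G2 E →
    ∀ {F α β} k → k ∉ F → E α → Δ E (∁ F) α β → RaisedAt E F α k
  raise-at {E = E} E+S⊆E g3S g2E {F} {α} {β} k k∉F Eα β∈Δ@(Eβ , β≡α , α<β) = by-cases (nonempty? F)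
    where
    by-cases : Dec (Nonempty F) → RaisedAt E F α k
    by-cases (yes (j₀ , j₀∈F)) with G2-step g2E k Eα Eβ (Δ∁⇒≼ {X = E} β∈Δ) α≉β αk≡βk
      where
      α≉β : ¬ (α ≈ β)
      α≉β α≈β = <-irrefl (α≈β j₀) (α<β j₀ (x∈p⇒x∉∁p j₀∈F))
      αk≡βk : α k ≡ β k
      αk≡βk = sym (β≡α k (x∉p⇒x∈∁p k∉F))
    ... | ε , Eε , α≼ε , αk<εk , agree =
      ε , Eε , α≼ε , αk<εk , λ j j∈F → agree j (α<β j (x∈p⇒x∉∁p j∈F))
    by-cases (no F-empty) with ideal-above E+S⊆E g3S Eα
    ... | ε , Eε , α<ε =
      ε , Eε , (λ j → <⇒≤ (α<ε j)) , α<ε k , λ j j∈F → contradiction (j , j∈F) F-empty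

proposition1p4 : (d : ℕ) (S E : SubsetNd d) → IsGoodSemigroup S → IsGoodIdeal S E →
    (α : Vecℕ d) → E α → (F : Subset d) → F ≢ ⊤ →
    Σ (Subset d) (λ H → (∣ H ∣ ≡ d ∸ 1) × (F ⊆ H) ×
      ((G : Subset d) → F ⊆ G → G ⊆ H → IsEmptyΔ E G α)) →
    IsEmptyΔ E (∁ F) α
proposition1p4 zero _ _ _ _ _ _ [] []≢⊤ _ _ _ = contradiction refl []≢⊤
proposition1p4 (suc m) S E (_ , _ , _ , g3S) (_ , E+S⊆E , _ , g2E) α Eα F _
  (H , ∣H∣≡m , F⊆H , Δ-empty) β β∈Δ
  with ∣p∣≡n⇒unique∉ ∣H∣≡m
... | k , k∉H , unique-∉H
  with raise-at E+S⊆E g3S g2E k (λ k∈F → k∉H (F⊆H k∈F)) Eα β∈Δ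
... | ε , Eε , α≼ε , αk<εk , ε≡α-on-F = Δ-empty G F⊆G G⊆H ε (Δ-agreement {X = E} Eε α≼ε)
  where
  G : Subset (suc m)
  G = agreement ε α
  F⊆G : F ⊆ G
  F⊆G {j} j∈F = ∈-agreement⁺ ε α (ε≡α-on-F j j∈F)
  G⊆H : G ⊆ H
  G⊆H {j} j∈G with j ∈? H
  ... | yes j∈H = j∈H
  ... | no j∉H with unique-∉H j∉H
  ... | refl = contradiction (∈-agreement⁻ ε α j∈G) (≢-sym (<⇒≢ αk<εk))
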